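{- For every $n$-vertex tree $T$, $h(T)=O(\log n)$; that is, there is an absolute constant $c$ such that every tree $T$ with $n\ge2$ vertices satisfies $h(T)\le c\log n$.
   Context: Hunters \& Rabbit game on a graph $G$ with $k$ hunters: a hunters' strategy is a sequence $\mathcal H=(H_1,H_2,\ldots)$ of sets $H_i\subseteq V(G)$ with $|H_i|\le k$. A rabbit's strategy is a sequence $(r_0,r_1,\ldots)$ of vertices with $r_i$ adjacent to $r_{i-1}$ for all $i\ge1$. $\mathcal H$ is winning if for every rabbit's strategy there is $i\ge1$ with $r_{i-1}\in H_i$. The hunter number $h(G)$ is the minimum $k$ such that $k$ hunters have a winning strategy on $G$. -}

module Defs where

open import Data.Nat using (ℕ; suc; _≤_)
open import Data.Bool using (Bool; true; false)
open import Data.Fin using (Fin)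
open import Data.Fin.Subset using (Subset; _∈_; ∣_∣)
open import Data.List using (List; []; _∷_; length)
open import Data.List.Relation.Unary.Unique.Propositional using (Unique)
open import Data.Product using (Σ; ∃; _×_; proj₁)
open import Data.Unit using (⊤)
open import Data.Empty using (⊥)
open import Relation.Binary.PropositionalEquality using (_≡_)
open import Relation.Nullary using (¬_)

record Graph (n : ℕ) : Set where
  field
    adj   : Fin n → Fin n → Bool
    sym   : ∀ u v → adj u v ≡ adj v u
    irrefl : ∀ v → adj v v ≡ false

open Graph public

module _ {n : ℕ} (G : Graph n) where

  Adj : Fin n → Fin n → Set
  Adj u v = adj G u v ≡ true

  data Walk : Fin n → Fin n → Set where
    here : ∀ {u} → Walk u u
    step : ∀ {u w v} → Adj u w → Walk w v → Walk u v

  Connected : Set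
  Connected = ∀ u v → Walk u v

  ChainTo : Fin n → List (Fin n) → Set
  ChainTo x []            = ⊤
  ChainTo x (v ∷ [])      = Adj v x
  ChainTo x (v ∷ w ∷ vs)  = Adj v w × ChainTo x (w ∷ vs)

  IsCycle : List (Fin n) → Set
  IsCycle []       = ⊥
  IsCycle (v ∷ vs) = (3 ≤ length (v ∷ vs)) × Unique (v ∷ vs) × ChainTo v (v ∷ vs)

  Acyclic : Set
  Acyclic = ∀ (c : List (Fin n)) → ¬ IsCycle c

  IsTree : Set
  IsTree = Connected × Acyclic

  HuntersStrategy : ℕ → Set
  HuntersStrategy k = Σ (ℕ → Subset n) λ H → ∀ i → ∣ H i ∣ ≤ k

  RabbitStrategy : Set
  RabbitStrategy = Σ (ℕ → Fin n) λ r → ∀ i → Adj (r i) (r (suc i))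

  -- H is winning: for every rabbit strategy r there is i ≥ 1 with r_{i-1} ∈ H_i
  -- (written with i = j+1)
  IsWinning : (ℕ → Subset n) → Set
  IsWinning H = (r : RabbitStrategy) → ∃ λ j → proj₁ r j ∈ H (suc j)

  -- h(G) ≤ k : k hunters have a winning strategy
  -- (h(G) is the minimum such k, so h(G) ≤ k iff this holds)
  HunterNumber≤ : ℕ → Set
  HunterNumber≤ k = Σ (HuntersStrategy k) λ H → IsWinning (proj₁ H)

-- Root the tree at a vertex and give every vertex its BFS depth; the parent
-- of a vertex is a neighbour one level closer to the root.  Acyclicity forces
-- every edge to join a vertex with its parent (otherwise the ancestor paths
-- of the two endpoints close up into a cycle), so the subtree below a vertex
-- v is separated from the rest of the tree by v alone.  For any vertex set R
-- a centroid c exists: the subtree of c holds at least half of R, the subtree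
-- of each child of c at most half.
--
-- Hunters sweep a region R whose outer boundary is occupied by hunters on G:
-- they add a permanent hunter on the centroid c, sweep each child region and
-- the region outside the subtree of c recursively (each holds at most half
-- of R), and finally search c.  Hence |R| < 2^d needs rounds of |G| + d
-- hunters, and a tree with n < 2^(⌊log₂ n⌋+1) vertices needs ⌊log₂ n⌋ + 1.

module Submission where

open import Defs hiding (sym)
open import Data.Bool using (true; false)
import Data.Bool.Properties as Bool
open import Data.Empty using (⊥; ⊥-elim)
open import Data.Fin using (Fin; _≟_) renaming (zero to fzero; suc to fsuc)
open import Data.Fin.Properties using (any?)
open import Data.Fin.Subset using (Subset; ⁅_⁆; _∪_; ∣_∣; _∈_; _∉_) renaming (⊥ to ∅; _⊆_ to _⊆ₛ_)
open import Data.Fin.Subset.Properties using (x∈p∪q⁺; x∈⁅x⁆; ∣⊥∣≡0; ∪-identityˡ; ∣p∣≤∣x∷p∣; _∈?_)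
open import Data.List using (List; []; _∷_; _++_; _∷ʳ_; length; applyUpTo; applyDownFrom; filter; allFin)
open import Data.List.Properties using (length-++; ++-assoc; length-applyUpTo; length-applyDownFrom; applyUpTo-∷ʳ; applyDownFrom-∷ʳ)
open import Data.List.Membership.Propositional using () renaming (_∈_ to _∈ₗ_)
open import Data.List.Membership.Propositional.Properties using (∈-applyUpTo⁻; ∈-applyDownFrom⁻; ∈-filter⁺; ∈-filter⁻; ∈-allFin)
open import Data.List.Relation.Unary.All as All using (All; []; _∷_)
import Data.List.Relation.Unary.All.Properties as All
open import Data.List.Relation.Unary.Any using (here; there)
open import Data.List.Relation.Unary.Linked using (Linked; [-]; _∷_)
import Data.List.Relation.Unary.Linked.Properties as Linked
open import Data.List.Relation.Unary.Unique.Propositional using (Unique)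
import Data.List.Relation.Unary.Unique.Propositional.Properties as Unique
open import Data.List.Relation.Binary.Disjoint.Propositional using (Disjoint)
open import Data.Nat using (ℕ; zero; suc; _+_; _*_; _^_; _≤_; _<_; z≤n; s≤s; pred; _<?_)
open import Data.Nat.Properties hiding (_≟_)
open import Data.Nat.Induction using (<-wellFounded)
open import Data.Nat.Logarithm using (⌊log₂_⌋; ⌊log₂⌋-mono-≤; ⌊log₂[2^n]⌋≡n)
open import Data.Product using (Σ; ∃; _×_; _,_; proj₁; proj₂)
open import Data.Sum using (_⊎_; inj₁; inj₂)
open import Data.Unit using (⊤; tt)
open import Data.Vec using (_∷_)
open import Function using (_∘_)
open import Induction.WellFounded as WF using ()
open import Level using (0ℓ)
open import Relation.Binary.Definitions using (tri<; tri≈; tri>)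
import Relation.Binary.Construct.On as On
open import Relation.Binary.PropositionalEquality using (_≡_; _≢_; refl; sym; trans; cong; cong₂; subst; module ≡-Reasoning)
open import Relation.Nullary using (¬_; Dec; yes; no; ¬?)
open import Relation.Nullary.Decidable using (_×-dec_; _⊎-dec_)
open import Relation.Unary using (Pred; Decidable; _⊆_; _∩_; ∁)
open import Relation.Unary.Properties using (_∩?_; ∁?)

least : {P : ℕ → Set} → (∀ i → Dec (P i)) → ∀ {w} → P w →
        Σ ℕ λ k → P k × (∀ {i} → i < k → ¬ P i)
least P? {zero} pw = 0 , pw , λ ()
least P? {suc w} pw with P? 0
... | yes p0 = 0 , p0 , λ ()
... | no ¬p0 with least (P? ∘ suc) {w} pw
...   | k , pk , below = suc k , pk , λ { {zero} _ → ¬p0 ; {suc i} i<k → below (≤-pred i<k) }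

indicator : {A : Set} → Dec A → ℕ
indicator (yes _) = 1
indicator (no _)  = 0

count : ∀ {m} {P : Pred (Fin m) 0ℓ} → Decidable P → ℕ
count {zero}  P? = 0
count {suc m} P? = indicator (P? fzero) + count (P? ∘ fsuc)

indicator-mono : {A B : Set} (A? : Dec A) (B? : Dec B) → (A → B) → indicator A? ≤ indicator B?
indicator-mono (yes a) (yes _) _   = ≤-refl
indicator-mono (yes a) (no ¬b) A⇒B = ⊥-elim (¬b (A⇒B a))
indicator-mono (no _)  _       _   = z≤n

count-mono : ∀ {m} {P Q : Pred (Fin m) 0ℓ} (P? : Decidable P) (Q? : Decidable Q) →
             P ⊆ Q → count P? ≤ count Q?
count-mono {zero}  P? Q? P⊆Q = z≤n
count-mono {suc m} P? Q? P⊆Q =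
  +-mono-≤ (indicator-mono (P? fzero) (Q? fzero) P⊆Q) (count-mono (P? ∘ fsuc) (Q? ∘ fsuc) P⊆Q)

count-strict : ∀ {m} {P Q : Pred (Fin m) 0ℓ} (P? : Decidable P) (Q? : Decidable Q) →
               P ⊆ Q → ∀ {x} → Q x → ¬ P x → count P? < count Q?
count-strict P? Q? P⊆Q {fzero} qx ¬px with P? fzero | Q? fzero
... | yes px | _     = ⊥-elim (¬px px)
... | no _   | no ¬q = ⊥-elim (¬q qx)
... | no _   | yes _ = s≤s (count-mono (P? ∘ fsuc) (Q? ∘ fsuc) P⊆Q)
count-strict P? Q? P⊆Q {fsuc x} qx ¬px =
  +-mono-≤-< (indicator-mono (P? fzero) (Q? fzero) P⊆Q) (count-strict (P? ∘ fsuc) (Q? ∘ fsuc) P⊆Q qx ¬px)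

count-positive : ∀ {m} {P : Pred (Fin m) 0ℓ} (P? : Decidable P) → ∀ {x} → P x → 0 < count P?
count-positive P? {fzero} px with P? fzero
... | yes _  = s≤s z≤n
... | no ¬px = ⊥-elim (¬px px)
count-positive P? {fsuc x} px = ≤-trans (count-positive (P? ∘ fsuc) px) (m≤n+m _ _)

count-bounded : ∀ {m} {P : Pred (Fin m) 0ℓ} (P? : Decidable P) → count P? ≤ m
count-bounded {zero}  P? = z≤n
count-bounded {suc m} P? with P? fzero
... | yes _ = s≤s (count-bounded (P? ∘ fsuc))
... | no _  = m≤n⇒m≤1+n (count-bounded (P? ∘ fsuc))

count-split : ∀ {m} {R S : Pred (Fin m) 0ℓ} (R? : Decidable R) (S? : Decidable S) →
              count R? ≡ count (R? ∩? S?) + count (R? ∩? ∁? S?)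
count-split {zero}  R? S? = refl
count-split {suc m} R? S? with R? fzero | S? fzero
... | yes _ | yes _ = cong suc (count-split (R? ∘ fsuc) (S? ∘ fsuc))
... | yes _ | no _  = trans (cong suc (count-split (R? ∘ fsuc) (S? ∘ fsuc))) (sym (+-suc _ _))
... | no _  | yes _ = count-split (R? ∘ fsuc) (S? ∘ fsuc)
... | no _  | no _  = count-split (R? ∘ fsuc) (S? ∘ fsuc)

module GraphFacts {n : ℕ} (G : Graph n) where

  _~_ : Fin n → Fin n → Set
  _~_ = Adj G

  adj? : ∀ x y → Dec (x ~ y)
  adj? x y = adj G x y Bool.≟ true

  ~-sym : ∀ {x y} → x ~ y → y ~ x
  ~-sym {x} {y} x~y = trans (Graph.sym G y x) x~y

  ~-irrefl : ∀ {x} → ¬ x ~ x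
  ~-irrefl {x} x~x with trans (sym x~x) (irrefl G x)
  ... | ()

  chainTo-linked : ∀ vs {x} → Linked _~_ (vs ∷ʳ x) → ChainTo G x vs
  chainTo-linked []           _              = tt
  chainTo-linked (v ∷ [])     (v~x ∷ [-])    = v~x
  chainTo-linked (v ∷ w ∷ vs) (v~w ∷ linked) = v~w , chainTo-linked (w ∷ vs) linked

  linked-join : ∀ xs {x y ys} → Linked _~_ (xs ∷ʳ x) → x ~ y → Linked _~_ (y ∷ ys) →
                Linked _~_ ((xs ∷ʳ x) ++ (y ∷ ys))
  linked-join []           [-]             x~y rest = x~y ∷ rest
  linked-join (v ∷ [])     (v~x ∷ [-])     x~y rest = v~x ∷ x~y ∷ rest
  linked-join (v ∷ w ∷ vs) (v~w ∷ linked)  x~y rest = v~w ∷ linked-join (w ∷ vs) linked x~y rest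

  closing-cycle : ∀ (xs ys : ℕ → Fin n) {j m} → 1 ≤ j → 1 ≤ m → xs j ≡ ys m → xs 0 ~ ys 0 →
    (∀ {i} → i < j → xs (suc i) ~ xs i) →
    (∀ {i} → i < m → ys i ~ ys (suc i)) →
    (∀ {i k} → k < i → i ≤ j → xs i ≢ xs k) →
    (∀ {i k} → i < k → k < m → ys i ≢ ys k) →
    (∀ {i k} → i ≤ j → k < m → xs i ≢ ys k) →
    IsCycle G (applyDownFrom xs (suc j) ++ applyUpTo ys m)
  closing-cycle xs ys {j} {m} 1≤j 1≤m xj≡ym x₀~y₀
                xs-edge ys-edge xs-distinct ys-distinct xs≢ys =
    long , unique , chainTo-linked (down ++ up) (subst (Linked _~_) (sym shape) joined)
    where
      down = applyDownFrom xs (suc j)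
      up   = applyUpTo ys m

      long : 3 ≤ length (down ++ up)
      long = subst (3 ≤_)
        (sym (trans (length-++ down) (cong₂ _+_ (length-applyDownFrom xs (suc j)) (length-applyUpTo ys m))))
        (s≤s (+-mono-≤ 1≤j 1≤m))

      disjoint : Disjoint down up
      disjoint (v∈down , v∈up) with ∈-applyDownFrom⁻ xs v∈down | ∈-applyUpTo⁻ ys v∈up
      ... | i , i<1+j , refl | k , k<m , xi≡yk = xs≢ys (≤-pred i<1+j) k<m xi≡yk

      unique : Unique (down ++ up)
      unique = Unique.++⁺
        (Unique.applyDownFrom⁺₁ xs (suc j) (λ k<i i<1+j → xs-distinct k<i (≤-pred i<1+j)))
        (Unique.applyUpTo⁺₁ ys m ys-distinct)
        disjoint

      -- the closed walk, with its first vertex xs j = ys m repeated at the end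
      shape : (down ++ up) ∷ʳ xs j ≡ (applyDownFrom (xs ∘ suc) j ∷ʳ xs 0) ++ applyUpTo ys (suc m)
      shape = begin
        (down ++ up) ∷ʳ xs j   ≡⟨ ++-assoc down up (xs j ∷ []) ⟩
        down ++ (up ∷ʳ xs j)   ≡⟨ cong (λ z → down ++ (up ∷ʳ z)) xj≡ym ⟩
        down ++ (up ∷ʳ ys m)   ≡⟨ cong (down ++_) (applyUpTo-∷ʳ ys m) ⟩
        down ++ applyUpTo ys (suc m)
          ≡⟨ cong (_++ applyUpTo ys (suc m)) (applyDownFrom-∷ʳ xs j) ⟨
        (applyDownFrom (xs ∘ suc) j ∷ʳ xs 0) ++ applyUpTo ys (suc m) ∎
        where open ≡-Reasoning

      joined : Linked _~_ ((applyDownFrom (xs ∘ suc) j ∷ʳ xs 0) ++ applyUpTo ys (suc m))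
      joined = linked-join (applyDownFrom (xs ∘ suc) j)
        (subst (Linked _~_) (sym (applyDownFrom-∷ʳ xs j))
               (Linked.applyDownFrom⁺₁ xs (suc j) (xs-edge ∘ ≤-pred)))
        x₀~y₀
        (Linked.applyUpTo⁺₁ ys (suc m) (ys-edge ∘ ≤-pred))

module RootedTree {n : ℕ} (T : Graph n) (root : Fin n)
                  (connected : Connected T) (acyclic : Acyclic T) where

  open GraphFacts T public

  V : Set
  V = Fin n

  Within : ℕ → V → Set
  Within zero    x = x ≡ root
  Within (suc k) x = Within k x ⊎ ∃ λ u → x ~ u × Within k u

  within? : ∀ k → Decidable (Within k)
  within? zero    x = x ≟ root
  within? (suc k) x = within? k x ⊎-dec any? (λ u → adj? x u ×-dec within? k u)

  within-step : ∀ {k x u} → x ~ u → Within k u → Within (suc k) x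
  within-step x~u w = inj₂ (_ , x~u , w)

  walk-length : ∀ {x y} → Walk T x y → ℕ
  walk-length here       = 0
  walk-length (step _ w) = suc (walk-length w)

  within-walk : ∀ {x} (w : Walk T x root) → Within (walk-length w) x
  within-walk here         = refl
  within-walk (step x~u w) = within-step x~u (within-walk w)

  private
    shortest : ∀ x → Σ ℕ λ k → Within k x × (∀ {i} → i < k → ¬ Within i x)
    shortest x = least (λ k → within? k x) (within-walk (connected x root))

  depth : V → ℕ
  depth x = proj₁ (shortest x)

  depth-within : ∀ x → Within (depth x) x
  depth-within x = proj₁ (proj₂ (shortest x))

  depth-minimal : ∀ {k x} → Within k x → depth x ≤ k
  depth-minimal {x = x} w = ≮⇒≥ (λ k<depth → proj₂ (proj₂ (shortest x)) k<depth w)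

  depth-edge : ∀ {x u} → x ~ u → depth x ≤ suc (depth u)
  depth-edge x~u = depth-minimal (within-step x~u (depth-within _))

  depth-root : depth root ≡ 0
  depth-root = n≤0⇒n≡0 (depth-minimal refl)

  depth-zero : ∀ {x} → depth x ≡ 0 → x ≡ root
  depth-zero {x} d≡0 = subst (λ k → Within k x) d≡0 (depth-within x)

  nonroot : ∀ {x} → 0 < depth x → x ≢ root
  nonroot 0<d refl = <-irrefl (sym depth-root) 0<d

  -- the parent of x is a neighbour one level closer to the root
  -- (the root, having no such neighbour, is its own parent)
  parent : V → V
  parent x with any? (λ u → adj? x u ×-dec within? (pred (depth x)) u)
  ... | yes (u , _) = u
  ... | no  _       = x

  parent-spec : ∀ {x k} → depth x ≡ suc k → x ~ parent x × Within k (parent x)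
  parent-spec {x} {k} d≡1+k with any? (λ u → adj? x u ×-dec within? (pred (depth x)) u)
  ... | yes (u , x~u , w) = x~u , subst (λ d → Within (pred d) u) d≡1+k w
  ... | no none with subst (λ d → Within d x) d≡1+k (depth-within x)
  ...   | inj₁ w = ⊥-elim (1+n≰n (subst (_≤ k) d≡1+k (depth-minimal w)))
  ...   | inj₂ (u , x~u , w) = ⊥-elim (none (u , x~u , subst (λ d → Within (pred d) u) (sym d≡1+k) w))

  depth-nonroot : ∀ {x} → x ≢ root → depth x ≡ suc (pred (depth x))
  depth-nonroot {x} x≢root with depth x in d≡
  ... | zero  = ⊥-elim (x≢root (depth-zero d≡))
  ... | suc _ = refl

  parent-edge : ∀ {x} → x ≢ root → x ~ parent x × suc (depth (parent x)) ≡ depth x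
  parent-edge {x} x≢root = x~p , sym (trans d≡ (cong suc (≤-antisym k≤dp (depth-minimal w))))
    where
      d≡ = depth-nonroot x≢root
      spec = parent-spec d≡
      x~p = proj₁ spec
      w = proj₂ spec
      k≤dp : pred (depth x) ≤ depth (parent x)
      k≤dp = ≤-pred (subst (_≤ suc (depth (parent x))) d≡ (depth-edge x~p))

  depth-parent : ∀ {x} → x ≢ root → depth (parent x) < depth x
  depth-parent x≢root = ≤-reflexive (proj₂ (parent-edge x≢root))

  depth-rec : (P : V → Set) → (∀ x → (∀ y → depth y < depth x → P y) → P x) → ∀ x → P x
  depth-rec P hyp = WF.All.wfRec (On.wellFounded depth <-wellFounded) 0ℓ P
                      (λ x rec → hyp x (λ y → rec))

  ancestor : ℕ → V → V
  ancestor zero    x = x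
  ancestor (suc i) x = parent (ancestor i x)

  depth-ancestor : ∀ {i x} → i ≤ depth x → depth (ancestor i x) + i ≡ depth x
  depth-ancestor {zero}  {x} _     = +-identityʳ (depth x)
  depth-ancestor {suc i} {x} 1+i≤d = begin
    depth (parent a) + suc i    ≡⟨ +-suc _ i ⟩
    suc (depth (parent a)) + i  ≡⟨ cong (_+ i) (proj₂ (parent-edge a≢root)) ⟩
    depth a + i                 ≡⟨ ih ⟩
    depth x                     ∎
    where
      open ≡-Reasoning
      a = ancestor i x
      ih : depth a + i ≡ depth x
      ih = depth-ancestor (≤-trans (n≤1+n i) 1+i≤d)
      a≢root : a ≢ root
      a≢root = nonroot (+-cancelʳ-≤ i 1 (depth a) (subst (suc i ≤_) (sym ih) 1+i≤d))

  ancestor-nonroot : ∀ {i x} → i < depth x → ancestor i x ≢ root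
  ancestor-nonroot {i} {x} i<d = nonroot (+-cancelʳ-≤ i 1 (depth (ancestor i x))
                                   (subst (suc i ≤_) (sym (depth-ancestor (<⇒≤ i<d))) i<d))

  ancestor-edge : ∀ {i x} → i < depth x → ancestor i x ~ ancestor (suc i) x
  ancestor-edge i<d = proj₁ (parent-edge (ancestor-nonroot i<d))

  ancestor-at-depth : ∀ x → ancestor (depth x) x ≡ root
  ancestor-at-depth x = depth-zero (+-cancelʳ-≡ (depth x) _ 0 (depth-ancestor ≤-refl))

  ancestor-injective : ∀ {i k x} → i ≤ depth x → k ≤ depth x → ancestor i x ≡ ancestor k x → i ≡ k
  ancestor-injective {i} {k} {x} i≤d k≤d eq = +-cancelˡ-≡ (depth (ancestor i x)) i k (begin
    depth (ancestor i x) + i  ≡⟨ depth-ancestor i≤d ⟩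
    depth x                   ≡⟨ depth-ancestor k≤d ⟨
    depth (ancestor k x) + k  ≡⟨ cong (λ y → depth y + k) eq ⟨
    depth (ancestor i x) + k  ∎)
    where open ≡-Reasoning

  -- For an edge a ~ b with depth b = depth a + e, the ancestor paths of a and
  -- of b first meet at index j (ancestor j a = ancestor (j + e) b).  If j > 0
  -- they close up into a cycle with the edge a ~ b, so j = 0.
  module Meeting {a b : V} (a~b : a ~ b) {e : ℕ} (db : depth b ≡ depth a + e) where

    Meets : ℕ → Set
    Meets i = ancestor i a ≡ ancestor (i + e) b

    meets-at-root : Meets (depth a)
    meets-at-root = begin
      ancestor (depth a) a      ≡⟨ ancestor-at-depth a ⟩
      root                      ≡⟨ ancestor-at-depth b ⟨
      ancestor (depth b) b      ≡⟨ cong (λ k → ancestor k b) db ⟩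
      ancestor (depth a + e) b  ∎
      where open ≡-Reasoning

    private
      first = least (λ i → ancestor i a ≟ ancestor (i + e) b) {depth a} meets-at-root

    j : ℕ
    j = proj₁ first

    meets-j : Meets j
    meets-j = proj₁ (proj₂ first)

    before-j : ∀ {i} → i < j → ¬ Meets i
    before-j = proj₂ (proj₂ first)

    j≤depth : j ≤ depth a
    j≤depth = ≮⇒≥ (λ d<j → before-j d<j meets-at-root)

    depth-b-bound : ∀ {k} → k < j + e → k < depth b
    depth-b-bound k<j+e = <-≤-trans k<j+e (subst (j + e ≤_) (sym db) (+-monoˡ-≤ e j≤depth))

    aligned : ∀ {i k} → i ≤ depth a → k ≤ depth b → ancestor i a ≡ ancestor k b → k ≡ i + e
    aligned {i} {k} i≤da k≤db eq = +-cancelˡ-≡ (depth (ancestor i a)) k (i + e) (begin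
      depth (ancestor i a) + k        ≡⟨ cong (λ y → depth y + k) eq ⟩
      depth (ancestor k b) + k        ≡⟨ depth-ancestor k≤db ⟩
      depth b                         ≡⟨ db ⟩
      depth a + e                     ≡⟨ cong (_+ e) (depth-ancestor i≤da) ⟨
      depth (ancestor i a) + i + e    ≡⟨ +-assoc (depth (ancestor i a)) i e ⟩
      depth (ancestor i a) + (i + e)  ∎)
      where open ≡-Reasoning

    a-path-edge : ∀ {i} → i < j → ancestor (suc i) a ~ ancestor i a
    a-path-edge i<j = ~-sym (ancestor-edge (<-≤-trans i<j j≤depth))

    a-path-distinct : ∀ {i k} → k < i → i ≤ j → ancestor i a ≢ ancestor k a
    a-path-distinct k<i i≤j eq =
      <⇒≢ k<i (sym (ancestor-injective i≤da (≤-trans (<⇒≤ k<i) i≤da) eq))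
      where i≤da = ≤-trans i≤j j≤depth

    b-path-edge : ∀ {i} → i < j + e → ancestor i b ~ ancestor (suc i) b
    b-path-edge i<j+e = ancestor-edge (depth-b-bound i<j+e)

    b-path-distinct : ∀ {i k} → i < k → k < j + e → ancestor i b ≢ ancestor k b
    b-path-distinct i<k k<j+e eq =
      <⇒≢ i<k (ancestor-injective (<⇒≤ (<-trans i<k k<db)) (<⇒≤ k<db) eq)
      where k<db = depth-b-bound k<j+e

    paths-disjoint : ∀ {i k} → i ≤ j → k < j + e → ancestor i a ≢ ancestor k b
    paths-disjoint {i} {k} i≤j k<j+e eq with m≤n⇒m<n∨m≡n i≤j
    ... | inj₁ i<j  = before-j i<j (trans eq (cong (λ l → ancestor l b) k≡i+e))
      where k≡i+e = aligned (≤-trans i≤j j≤depth) (<⇒≤ (depth-b-bound k<j+e)) eq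
    ... | inj₂ refl = <⇒≢ k<j+e (aligned j≤depth (<⇒≤ (depth-b-bound k<j+e)) eq)

    no-late-meeting : 1 ≤ j → ⊥
    no-late-meeting 1≤j = acyclic _ (closing-cycle (λ i → ancestor i a) (λ i → ancestor i b)
      1≤j (≤-trans 1≤j (m≤m+n j e)) meets-j a~b
      a-path-edge b-path-edge a-path-distinct b-path-distinct paths-disjoint)

    meeting-at-start : a ≡ ancestor e b
    meeting-at-start with j in j≡ | meets-j
    ... | zero  | meets-0 = meets-0
    ... | suc _ | _       = ⊥-elim (no-late-meeting (subst (1 ≤_) (sym j≡) (s≤s z≤n)))

  depth-neighbour : ∀ {x y} → y ~ x → depth x < depth y → depth y ≡ depth x + 1
  depth-neighbour {x} {y} y~x dx<dy = trans (≤-antisym (depth-edge y~x) dx<dy) (+-comm 1 (depth x))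

  edge-to-parent : ∀ {x y} → x ~ y → (x ≢ root × y ≡ parent x) ⊎ (y ≢ root × x ≡ parent y)
  edge-to-parent {x} {y} x~y with <-cmp (depth x) (depth y)
  ... | tri< dx<dy _ _ =
    inj₂ (nonroot (≤-<-trans z≤n dx<dy) , Meeting.meeting-at-start x~y (depth-neighbour (~-sym x~y) dx<dy))
  ... | tri> _ _ dy<dx =
    inj₁ (nonroot (≤-<-trans z≤n dy<dx) , Meeting.meeting-at-start (~-sym x~y) (depth-neighbour x~y dy<dx))
  ... | tri≈ _ dx≡dy _ = ⊥-elim (~-irrefl (subst (x ~_) (sym x≡y) x~y))
    where x≡y = Meeting.meeting-at-start x~y (trans (sym dx≡dy) (sym (+-identityʳ (depth x))))

  AncestorWithin : ℕ → V → V → Set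
  AncestorWithin zero    v x = x ≡ v
  AncestorWithin (suc f) v x = x ≡ v ⊎ AncestorWithin f v (parent x)

  ancestorWithin? : ∀ f v → Decidable (AncestorWithin f v)
  ancestorWithin? zero    v x = x ≟ v
  ancestorWithin? (suc f) v x = (x ≟ v) ⊎-dec ancestorWithin? f v (parent x)

  Subtree : V → Pred V 0ℓ
  Subtree v x = AncestorWithin (depth x) v x

  subtree? : ∀ v → Decidable (Subtree v)
  subtree? v x = ancestorWithin? (depth x) v x

  subtree-refl : ∀ x → Subtree x x
  subtree-refl x with depth x
  ... | zero  = refl
  ... | suc _ = inj₁ refl

  subtree-parent : ∀ {v x} → x ≢ root → Subtree v (parent x) → Subtree v x
  subtree-parent {v} {x} x≢root s =
    subst (λ d → AncestorWithin d v x) (proj₂ (parent-edge x≢root)) (inj₂ s)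

  subtree-step : ∀ {v x} → Subtree v x → x ≢ v → x ≢ root × Subtree v (parent x)
  subtree-step {v} {x} s x≢v with x ≟ root
  ... | yes refl = ⊥-elim (x≢v (subst (λ d → AncestorWithin d v root) depth-root s))
  ... | no x≢root with subst (λ d → AncestorWithin d v x) (sym (proj₂ (parent-edge x≢root))) s
  ...   | inj₁ x≡v = ⊥-elim (x≢v x≡v)
  ...   | inj₂ s′  = x≢root , s′

  subtree-ind : ∀ {v} (P : V → Set) → P v → (∀ {x} → x ≢ root → P (parent x) → P x) →
                ∀ {x} → Subtree v x → P x
  subtree-ind {v} P base up {x} = depth-rec (λ x → Subtree v x → P x) inductive-step x
    where
      inductive-step : ∀ x → (∀ y → depth y < depth x → Subtree v y → P y) → Subtree v x → P x
      inductive-step x ih s with x ≟ v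
      ... | yes refl = base
      ... | no x≢v with subtree-step s x≢v
      ...   | x≢root , s′ = up x≢root (ih _ (depth-parent x≢root) s′)

  subtree-depth : ∀ {v x} → Subtree v x → depth v ≤ depth x
  subtree-depth {v} = subtree-ind (λ x → depth v ≤ depth x) ≤-refl
                                  (λ x≢root dv≤dp → <⇒≤ (≤-<-trans dv≤dp (depth-parent x≢root)))

  subtree-trans : ∀ {c u x} → Subtree c u → Subtree u x → Subtree c x
  subtree-trans {c} scu = subtree-ind (Subtree c) scu subtree-parent

  subtree-root : ∀ x → Subtree root x
  subtree-root = depth-rec (Subtree root) inductive-step
    where
      inductive-step : ∀ x → (∀ y → depth y < depth x → Subtree root y) → Subtree root x
      inductive-step x ih with x ≟ root
      ... | yes refl  = subtree-refl root
      ... | no x≢root = subtree-parent x≢root (ih _ (depth-parent x≢root))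

  parent-outside : ∀ {u} → u ≢ root → ¬ Subtree u (parent u)
  parent-outside u≢root s = <⇒≱ (depth-parent u≢root) (subtree-depth s)

  Child : V → V → Set
  Child c u = u ≢ root × parent u ≡ c

  child? : ∀ c → Decidable (Child c)
  child? c u = ¬? (u ≟ root) ×-dec (parent u ≟ c)

  child-subtree : ∀ {c u} → Child c u → Subtree c u
  child-subtree {c} (u≢root , refl) = subtree-parent u≢root (subtree-refl c)

  towards-child : ∀ {c x} → Subtree c x → x ≡ c ⊎ ∃ λ u → Child c u × Subtree u x
  towards-child {c} = subtree-ind (λ x → x ≡ c ⊎ ∃ λ u → Child c u × Subtree u x) (inj₁ refl) up
    where
      up : ∀ {x} → x ≢ root → parent x ≡ c ⊎ (∃ λ u → Child c u × Subtree u (parent x)) →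
           x ≡ c ⊎ ∃ λ u → Child c u × Subtree u x
      up x≢root (inj₁ px≡c)             = inj₂ (_ , (x≢root , px≡c) , subtree-refl _)
      up x≢root (inj₂ (u , child , su)) = inj₂ (u , child , subtree-parent x≢root su)

  subtree-shrinks : ∀ {c u} → Child c u → count (subtree? u) < count (subtree? c)
  subtree-shrinks {c} {u} child@(u≢root , refl) =
    count-strict (subtree? u) (subtree? c) (subtree-trans (child-subtree child))
                 (subtree-refl c) (parent-outside u≢root)

  module _ {R : Pred V 0ℓ} (R? : Decidable R) where

    weight : V → ℕ
    weight v = count (R? ∩? subtree? v)

    Heavy : V → Set
    Heavy v = count R? ≤ 2 * weight v

    IsCentroid : V → Set
    IsCentroid c = Heavy c × (∀ {u} → Child c u → 2 * weight u ≤ count R?)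

    -- from a heavy vertex, walk down to a child holding more than half of R while possible
    descend : ∀ fuel x → count (subtree? x) < fuel → Heavy x → ∃ IsCentroid
    descend (suc fuel) x size<fuel heavy with any? (λ u → child? x u ×-dec (count R? <? 2 * weight u))
    ... | yes (u , child , heavier) =
      descend fuel u (≤-trans (subtree-shrinks child) (≤-pred size<fuel)) (<⇒≤ heavier)
    ... | no none = x , heavy , λ {u} child → ≮⇒≥ (λ heavier → none (u , child , heavier))

    root-heavy : Heavy root
    root-heavy = ≤-trans (count-mono R? (R? ∩? subtree? root) (λ {x} Rx → Rx , subtree-root x))
                         (m≤m+n (weight root) (weight root + 0))

    centroid : ∃ IsCentroid
    centroid = descend (suc (count (subtree? root))) root ≤-refl root-heavy

-- Hunting schedules: a schedule is a list of rounds (sets of hunted vertices)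
-- played at consecutive steps.  Everything here holds in any graph.
module Sweeping {n : ℕ} (T : Graph n) where

  V : Set
  V = Fin n

  Avoids : (ℕ → V) → ℕ → List (Subset n) → Set
  Avoids r t []      = ⊤
  Avoids r t (h ∷ L) = r t ∉ h × Avoids r (suc t) L

  time-++ : ∀ t (L₁ L₂ : List (Subset n)) → t + length L₁ + length L₂ ≡ t + length (L₁ ++ L₂)
  time-++ t L₁ L₂ = trans (+-assoc t (length L₁) (length L₂)) (cong (t +_) (sym (length-++ L₁)))

  avoids-++ : ∀ {r} t L₁ {L₂} → Avoids r t (L₁ ++ L₂) → Avoids r t L₁ × Avoids r (t + length L₁) L₂
  avoids-++ {r} t []       {L₂} av = tt , subst (λ s → Avoids r s L₂) (sym (+-identityʳ t)) av
  avoids-++ {r} t (h ∷ L₁) {L₂} (r∉h , av) with avoids-++ (suc t) L₁ av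
  ... | av₁ , av₂ = (r∉h , av₁) , subst (λ s → Avoids r s L₂) (sym (+-suc t (length L₁))) av₂

  Clears : Pred V 0ℓ → List (Subset n) → Set
  Clears R L = ∀ (rabbit : RabbitStrategy T) t → Avoids (proj₁ rabbit) t L →
               ¬ R (proj₁ rabbit (t + length L))

  Guarded : Pred V 0ℓ → Subset n → Set
  Guarded R G = ∀ {x y} → Adj T x y → ¬ R x → R y → x ∈ G

  stays-out : ∀ {R G} → Guarded R G → ∀ L → All (G ⊆ₛ_) L →
              ∀ (rabbit : RabbitStrategy T) t → Avoids (proj₁ rabbit) t L →
              ¬ R (proj₁ rabbit t) → ¬ R (proj₁ rabbit (t + length L))
  stays-out {R} guard [] _ (r , _) t _ out = subst (λ s → ¬ R (r s)) (sym (+-identityʳ t)) out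
  stays-out {R} guard (h ∷ L) (G⊆h ∷ holds) (r , moves) t (r∉h , av) out =
    subst (λ s → ¬ R (r s)) (sym (+-suc t (length L))) (stays-out guard L holds (r , moves) (suc t) av out′)
    where
      out′ : ¬ R (r (suc t))
      out′ inside = r∉h (G⊆h (guard (moves t) out inside))

  clear-persists : ∀ {R G} L₁ {L₂} → Guarded R G → All (G ⊆ₛ_) L₂ → Clears R L₁ → Clears R (L₁ ++ L₂)
  clear-persists {R} L₁ {L₂} guard holds cleared rabbit t av with avoids-++ t L₁ av
  ... | av₁ , av₂ = subst (λ s → ¬ R (proj₁ rabbit s)) (time-++ t L₁ L₂)
                      (stays-out guard L₂ holds rabbit (t + length L₁) av₂ (cleared rabbit t av₁))

  clears-later : ∀ {R} L₁ {L₂} → Clears R L₂ → Clears R (L₁ ++ L₂)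
  clears-later {R} L₁ {L₂} cleared rabbit t av =
    subst (λ s → ¬ R (proj₁ rabbit s)) (time-++ t L₁ L₂)
          (cleared rabbit (t + length L₁) (proj₂ (avoids-++ t L₁ av)))

  final-round : ∀ {R G h} L → Guarded R G → G ⊆ₛ h →
    (∀ (rabbit : RabbitStrategy T) t → Avoids (proj₁ rabbit) t L →
       proj₁ rabbit (t + length L) ∉ h → ¬ R (proj₁ rabbit (t + length L))) →
    Clears R (L ++ h ∷ [])
  final-round {R} {h = h} L guard G⊆h before rabbit t av with avoids-++ t L av
  ... | av₁ , (r∉h , _) = subst (λ s → ¬ R (proj₁ rabbit s)) (time-++ t L (h ∷ []))
      (stays-out guard (h ∷ []) (G⊆h ∷ []) rabbit (t + length L) (r∉h , tt) (before rabbit t av₁ r∉h))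

  Bounded : Subset n → ℕ → List (Subset n) → Set
  Bounded G d = All (λ h → G ⊆ₛ h × ∣ h ∣ ≤ ∣ G ∣ + d)

  record Sweep (G : Subset n) (d : ℕ) (R : Pred V 0ℓ) : Set where
    field
      rounds  : List (Subset n)
      bounded : Bounded G d rounds
      clears  : Clears R rounds

  sweep-each : ∀ {G d} {Q : V → Pred V 0ℓ} (us : List V) →
    (∀ {u} → u ∈ₗ us → Guarded (Q u) G) → (∀ {u} → u ∈ₗ us → Sweep G d (Q u)) →
    Σ (List (Subset n)) λ L → Bounded G d L × (∀ {u} → u ∈ₗ us → Clears (Q u) L)
  sweep-each []       _     _      = [] , [] , λ ()
  sweep-each {Q = Q} (u ∷ us) guard sweeps with sweep-each us (guard ∘ there) (sweeps ∘ there)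
  ... | L , bounded-L , clears-L = rounds ++ L , All.++⁺ bounded bounded-L , clears-all
    where
      open Sweep (sweeps (here refl))
      clears-all : ∀ {v} → v ∈ₗ u ∷ us → Clears (Q v) (rounds ++ L)
      clears-all (here refl) = clear-persists rounds (guard (here refl)) (All.map proj₁ bounded-L) clears
      clears-all {v} (there v∈us) = clears-later {Q v} rounds (clears-L v∈us)

  roundAt : List (Subset n) → ℕ → Subset n
  roundAt []      _       = ∅
  roundAt (h ∷ L) zero    = h
  roundAt (h ∷ L) (suc i) = roundAt L i

  roundAt-all : ∀ {P : Subset n → Set} L → All P L → P ∅ → ∀ i → P (roundAt L i)
  roundAt-all []      _          p∅ _       = p∅
  roundAt-all (h ∷ L) (ph ∷ _)   p∅ zero    = ph
  roundAt-all (h ∷ L) (_ ∷ all)  p∅ (suc i) = roundAt-all L all p∅ i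

  avoids-or-caught : ∀ r L t → Avoids r t L ⊎ ∃ λ i → r (t + i) ∈ roundAt L i
  avoids-or-caught r []      t = inj₁ tt
  avoids-or-caught r (h ∷ L) t with r t ∈? h
  ... | yes r∈h = inj₂ (0 , subst (λ s → r s ∈ h) (sym (+-identityʳ t)) r∈h)
  ... | no r∉h with avoids-or-caught r L (suc t)
  ...   | inj₁ av = inj₁ (r∉h , av)
  ...   | inj₂ (i , caught) = inj₂ (suc i , subst (λ s → r s ∈ roundAt L i) (sym (+-suc t i)) caught)

  -- a sweep of the whole vertex set is a winning strategy for d hunters;
  -- round i is played at step i + 1
  sweep-wins : ∀ {d} → Sweep ∅ d (λ _ → ⊤) → HunterNumber≤ T d
  sweep-wins {d} S = (hunters , size) , wins
    where
      open Sweep S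
      hunters : ℕ → Subset n
      hunters i = roundAt rounds (pred i)
      size : ∀ i → ∣ hunters i ∣ ≤ d
      size i = roundAt-all {P = λ h → ∣ h ∣ ≤ d} rounds
        (All.map (λ b → subst (_ ≤_) (cong (_+ d) (∣⊥∣≡0 n)) (proj₂ b)) bounded)
        (subst (_≤ d) (sym (∣⊥∣≡0 n)) z≤n) (pred i)
      wins : IsWinning T hunters
      wins (r , moves) with avoids-or-caught r rounds 0
      ... | inj₁ av           = ⊥-elim (clears (r , moves) 0 av tt)
      ... | inj₂ (i , caught) = i , caught

∣⁅x⁆∪p∣≤1+∣p∣ : ∀ {m} (x : Fin m) (p : Subset m) → ∣ ⁅ x ⁆ ∪ p ∣ ≤ suc ∣ p ∣
∣⁅x⁆∪p∣≤1+∣p∣ fzero    (s ∷ p) rewrite ∪-identityˡ p = s≤s (∣p∣≤∣x∷p∣ s p)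
∣⁅x⁆∪p∣≤1+∣p∣ (fsuc x) (true ∷ p)  = s≤s (∣⁅x⁆∪p∣≤1+∣p∣ x p)
∣⁅x⁆∪p∣≤1+∣p∣ (fsuc x) (false ∷ p) = ∣⁅x⁆∪p∣≤1+∣p∣ x p

half-small : ∀ {a m} d → 2 * a ≤ m → m < 2 ^ suc d → a < 2 ^ d
half-small {a} d 2a≤m m<2^1+d = *-cancelˡ-< 2 a (2 ^ d) (≤-<-trans 2a≤m m<2^1+d)

light-complement : ∀ a b → a + b ≤ 2 * a → 2 * b ≤ a + b
light-complement a b a+b≤2a = subst (_≤ a + b) (cong (b +_) (sym (+-identityʳ b))) (+-monoˡ-≤ b b≤a)
  where
    b≤a : b ≤ a
    b≤a = +-cancelˡ-≤ a b a (subst (a + b ≤_) (cong (a +_) (+-identityʳ a)) a+b≤2a)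

module TreeSweep {n : ℕ} (T : Graph n) (root : Fin n)
                 (connected : Connected T) (acyclic : Acyclic T) where

  open RootedTree T root connected acyclic
  open Sweeping T hiding (V)

  -- R split at a centroid c into the regions below the children of c and the
  -- region outside the subtree of c; with c added to G all of them are guarded.
  module Split {R : Pred V 0ℓ} (R? : Decidable R) {G : Subset n} (guard : Guarded R G)
               {c : V} (centroid-c : IsCentroid R? c) where

    G′ : Subset n
    G′ = ⁅ c ⁆ ∪ G

    centre-guard : ∀ {x} → x ≡ c → x ∈ G′
    centre-guard refl = x∈p∪q⁺ (inj₁ (x∈⁅x⁆ c))

    old-guard : G ⊆ₛ G′
    old-guard x∈G = x∈p∪q⁺ (inj₂ x∈G)

    relax : ∀ {d L} → Bounded G′ d L → Bounded G (suc d) L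
    relax {d} = All.map λ (G′⊆h , small) →
      G′⊆h ∘ old-guard ,
      ≤-trans small (≤-trans (+-monoˡ-≤ d (∣⁅x⁆∪p∣≤1+∣p∣ c G)) (≤-reflexive (sym (+-suc ∣ G ∣ d))))

    Below : V → Pred V 0ℓ
    Below u = R ∩ Subtree u

    Above : Pred V 0ℓ
    Above = R ∩ ∁ (Subtree c)

    children : List V
    children = filter (child? c) (allFin n)

    -- an edge leaving the region below the child u either stays in the
    -- subtree of u (so leaves R, and is guarded by G) or goes up to c
    below-guarded : ∀ {u} → Child c u → Guarded (Below u) G′
    below-guarded {u} (u≢root , pu≡c) {x} {y} x~y outside (Ry , sy) with R? x
    ... | no ¬Rx = old-guard (guard x~y ¬Rx Ry)
    ... | yes Rx with edge-to-parent x~y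
    ...   | inj₁ (x≢root , y≡px) =
      ⊥-elim (outside (Rx , subtree-parent x≢root (subst (Subtree u) y≡px sy)))
    ...   | inj₂ (y≢root , x≡py) with y ≟ u
    ...     | yes refl = centre-guard (trans x≡py pu≡c)
    ...     | no y≢u   = ⊥-elim (outside (Rx , subst (Subtree u) (sym x≡py) (proj₂ (subtree-step sy y≢u))))

    -- an edge leaving the region above c either leaves R or enters the
    -- subtree of c, which is only possible through c itself
    above-guarded : Guarded Above G′
    above-guarded {x} {y} x~y outside (Ry , ¬sy) with R? x | subtree? c x
    ... | no ¬Rx | _      = old-guard (guard x~y ¬Rx Ry)
    ... | yes Rx | no ¬sx = ⊥-elim (outside (Rx , ¬sx))
    ... | yes Rx | yes sx with edge-to-parent x~y
    ...   | inj₂ (y≢root , x≡py) = ⊥-elim (¬sy (subtree-parent y≢root (subst (Subtree c) x≡py sx)))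
    ...   | inj₁ (x≢root , y≡px) with x ≟ c
    ...     | yes x≡c = centre-guard x≡c
    ...     | no x≢c  = ⊥-elim (¬sy (subst (Subtree c) (sym y≡px) (proj₂ (subtree-step sx x≢c))))

    below-small : ∀ {d u} → count R? < 2 ^ suc d → Child c u → weight R? u < 2 ^ d
    below-small {d} small child = half-small d (proj₂ centroid-c child) small

    above-small : ∀ {d} → count R? < 2 ^ suc d → count (R? ∩? ∁? (subtree? c)) < 2 ^ d
    above-small {d} small = half-small d 2outside≤R small
      where
        inside = weight R? c
        outside = count (R? ∩? ∁? (subtree? c))
        split : count R? ≡ inside + outside
        split = count-split R? (subtree? c)
        2outside≤R : 2 * outside ≤ count R?
        2outside≤R = subst (2 * outside ≤_) (sym split)
          (light-complement inside outside (subst (_≤ 2 * inside) split (proj₁ centroid-c)))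

    split-cover : ∀ {x} → R x → x ≢ c → (∃ λ u → Child c u × Below u x) ⊎ Above x
    split-cover {x} Rx x≢c with subtree? c x
    ... | no ¬sx = inj₂ (Rx , ¬sx)
    ... | yes sx with towards-child sx
    ...   | inj₁ x≡c              = ⊥-elim (x≢c x≡c)
    ...   | inj₂ (u , child , su) = inj₁ (u , child , Rx , su)

    cover-clears : ∀ L → (∀ {u} → u ∈ₗ children → Clears (Below u) L) → Clears Above L →
      ∀ (rabbit : RabbitStrategy T) t → Avoids (proj₁ rabbit) t L →
      proj₁ rabbit (t + length L) ∉ G′ → ¬ R (proj₁ rabbit (t + length L))
    cover-clears L below-clear above-clear rabbit t av r∉G′ inside
      with split-cover inside (r∉G′ ∘ centre-guard)
    ... | inj₁ (u , child , in-below) =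
      below-clear (∈-filter⁺ (child? c) (∈-allFin u) child) rabbit t av in-below
    ... | inj₂ in-above = above-clear rabbit t av in-above

    split-sweep : ∀ {d} → count R? < 2 ^ suc d →
      (∀ {Q} (Q? : Decidable Q) → count Q? < 2 ^ d → Guarded Q G′ → Sweep G′ d Q) →
      Sweep G (suc d) R
    split-sweep {d} small sweep-half = record
      { rounds  = L ++ G′ ∷ []
      ; bounded = All.++⁺ (All.++⁺ (relax below-bounded) (relax (Sweep.bounded above)))
                          ((old-guard , last-small) ∷ [])
      ; clears  = final-round L guard old-guard (cover-clears L below-cleared above-cleared)
      }
      where
        child-of : ∀ {u} → u ∈ₗ children → Child c u
        child-of u∈ = proj₂ (∈-filter⁻ (child? c) {xs = allFin n} u∈)

        below : Σ (List (Subset n)) λ L → Bounded G′ d L × (∀ {u} → u ∈ₗ children → Clears (Below u) L)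
        below = sweep-each children (λ u∈ → below-guarded (child-of u∈))
          λ {u} u∈ → sweep-half (R? ∩? subtree? u) (below-small {d} small (child-of u∈)) (below-guarded (child-of u∈))

        below-rounds : List (Subset n)
        below-rounds = proj₁ below

        below-bounded : Bounded G′ d below-rounds
        below-bounded = proj₁ (proj₂ below)

        above : Sweep G′ d Above
        above = sweep-half (R? ∩? ∁? (subtree? c)) (above-small {d} small) above-guarded

        L : List (Subset n)
        L = below-rounds ++ Sweep.rounds above

        below-cleared : ∀ {u} → u ∈ₗ children → Clears (Below u) L
        below-cleared {u} u∈ = clear-persists {Below u} below-rounds (below-guarded (child-of u∈))
          (All.map proj₁ (Sweep.bounded above)) (proj₂ (proj₂ below) u∈)

        above-cleared : Clears Above L
        above-cleared = clears-later {Above} below-rounds (Sweep.clears above)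

        last-small : ∣ G′ ∣ ≤ ∣ G ∣ + suc d
        last-small = ≤-trans (∣⁅x⁆∪p∣≤1+∣p∣ c G)
                             (≤-trans (s≤s (m≤m+n ∣ G ∣ d)) (≤-reflexive (sym (+-suc ∣ G ∣ d))))

  sweep : ∀ d {R : Pred V 0ℓ} (R? : Decidable R) → count R? < 2 ^ d → ∀ {G} → Guarded R G → Sweep G d R
  sweep zero    R? small guard = record
    { rounds = [] ; bounded = [] ; clears = λ _ _ _ inside → ≤⇒≯ (count-positive R? inside) small }
  sweep (suc d) R? small guard =
    Split.split-sweep R? guard (proj₂ (centroid R?)) small (λ Q? small′ → sweep d Q? small′)

tree-hunters : ∀ {n} d (T : Graph n) → IsTree T → n < 2 ^ d → HunterNumber≤ T d
tree-hunters {zero} d T _ _ = ((λ _ → ∅) , λ _ → subst (_≤ d) (sym (∣⊥∣≡0 0)) z≤n) , no-rabbit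
  where
    no-rabbit : IsWinning T (λ _ → ∅)
    no-rabbit (r , _) with r 0
    ... | ()
tree-hunters {suc n} d T (connected , acyclic) small =
  sweep-wins (sweep d (λ _ → yes tt) (≤-<-trans (count-bounded {P = λ _ → ⊤} (λ _ → yes tt)) small)
                    (λ _ outside _ → ⊥-elim (outside tt)))
  where
    open TreeSweep T fzero connected acyclic
    open Sweeping T

hunters-mono : ∀ {n} {T : Graph n} {k l} → k ≤ l → HunterNumber≤ T k → HunterNumber≤ T l
hunters-mono k≤l ((H , small) , wins) = (H , λ i → ≤-trans (small i) k≤l) , wins

log-bound : ∀ n → n < 2 ^ suc ⌊log₂ n ⌋
log-bound n = ≰⇒> λ 2^≤n →
  1+n≰n (subst (_≤ ⌊log₂ n ⌋) (⌊log₂[2^n]⌋≡n (suc ⌊log₂ n ⌋)) (⌊log₂⌋-mono-≤ 2^≤n))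

log-positive : ∀ {n} → 2 ≤ n → 1 ≤ ⌊log₂ n ⌋
log-positive {n} 2≤n = subst (_≤ ⌊log₂ n ⌋) (⌊log₂[2^n]⌋≡n 1) (⌊log₂⌋-mono-≤ 2≤n)

theorem13 : ∃ λ (c : ℕ) → ∀ (n : ℕ) → 2 ≤ n → (T : Graph n) → IsTree T → HunterNumber≤ T (c * ⌊log₂ n ⌋)
theorem13 = 2 , λ n 2≤n T tree →
  hunters-mono {T = T} (1+lg≤2lg 2≤n) (tree-hunters (suc ⌊log₂ n ⌋) T tree (log-bound n))
  where
    1+lg≤2lg : ∀ {n} → 2 ≤ n → suc ⌊log₂ n ⌋ ≤ 2 * ⌊log₂ n ⌋
    1+lg≤2lg {n} 2≤n = subst (suc ⌊log₂ n ⌋ ≤_) (cong (⌊log₂ n ⌋ +_) (sym (+-identityʳ ⌊log₂ n ⌋)))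
                        (+-monoˡ-≤ ⌊log₂ n ⌋ (log-positive 2≤n))
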